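{- Let $q$ and $x$ be indeterminates. For $n\in\mathbb{N}$ let $[n]=\frac{1-q^n}{1-q}$ and $[n]!=[1][2]\cdots[n]$ (with $[0]!=1$). Define the $q$-Stirling numbers of the second kind $S[n,k]$ by $S[0,k]=[k=0]$, $S[n,0]=[n=0]$ and $S[n,k]=S[n-1,k-1]+[k]\,S[n-1,k]$ for $n,k\ge 1$, and let $\varphi_n(x)=\sum_{k=0}^n S[n,k]\,x^k$. Then for every $n\ge 1$, $$\det\left(\varphi_{i+j}(x)\right)_{i,j=0}^{n-1}=x^{\binom{n}{2}}q^{\binom{n}{3}}\prod_{j=0}^{n-1}[j]!$$ and $$\det\left(\varphi_{i+j+1}(x)\right)_{i,j=0}^{n-1}=x^{\binom{n+1}{2}}q^{\binom{n+1}{3}}\prod_{j=0}^{n-1}[j]!.$$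
   Context: $[k=0]$ denotes the Iverson bracket (1 if $k=0$, else 0). -}

module Defs where

open import Level using (Level)
open import Data.Nat using (ℕ; zero; suc)
open import Data.Fin using (Fin; zero; suc; punchIn; toℕ)
open import Algebra.Bundles using (CommutativeRing)

-- All objects live in ℤ[q,x]; we state the identity in an arbitrary
-- commutative ring R at arbitrary elements q x (equivalent by the universal
-- property of the polynomial ring ℤ[q,x]).
module QStirling {c ℓ : Level} (R : CommutativeRing c ℓ) where
  open CommutativeRing R using (Carrier; _+_; _*_; -_; 0#; 1#)

  pow : Carrier → ℕ → Carrier
  pow a zero    = 1#
  pow a (suc n) = a * pow a n

  sumFin : (n : ℕ) → (Fin n → Carrier) → Carrier
  sumFin zero    f = 0#
  sumFin (suc n) f = f zero + sumFin n (λ i → f (suc i))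

  prodFin : (n : ℕ) → (Fin n → Carrier) → Carrier
  prodFin zero    f = 1#
  prodFin (suc n) f = f zero * prodFin n (λ i → f (suc i))

  qint : Carrier → ℕ → Carrier
  qint q zero    = 0#
  qint q (suc n) = 1# + q * qint q n

  qfact : Carrier → ℕ → Carrier
  qfact q zero    = 1#
  qfact q (suc n) = qfact q n * qint q (suc n)

  qS : Carrier → ℕ → ℕ → Carrier
  qS q zero    zero    = 1#
  qS q zero    (suc k) = 0#
  qS q (suc n) zero    = 0#
  qS q (suc n) (suc k) = qS q n k + qint q (suc k) * qS q n (suc k)

  φ : Carrier → Carrier → ℕ → Carrier
  φ q x n = sumFin (suc n) (λ k → qS q n (toℕ k) * pow x (toℕ k))

  det : (n : ℕ) → (Fin n → Fin n → Carrier) → Carrier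
  det zero    M = 1#
  det (suc n) M =
    sumFin (suc n) (λ j →
      pow (- 1#) (toℕ j) * (M zero j * det n (λ r s → M (suc r) (punchIn j s))))

-- Let L be a Stieltjes table: L 0 k = [k = 0] and
-- L (n+1) k = L n (k-1) + b k · L n k + lam k · L n (k+1). With Λ k = lam 0 ⋯ lam (k-1) the
-- tridiagonal recurrence is self-adjoint for the pairing Σ_k f k · g k · Λ k, so
-- L (i+j) 0 = Σ_k L i k · L j k · Λ k. This factors the Hankel matrix of (L n 0) through
-- the unitriangular matrix (L i k), so its n × n determinant is ∏_{k<n} Λ k.
--
-- Both φ n and φ (n+1) / x are column 0 of such tables, namely Σ_a S n a · P a k where S
-- is the q-Stirling triangle (respectively (n, k) ↦ S[n+1, k+1]) and P is the bidiagonal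
-- table with P (a+1) k = P a (k-1) + x q^k P a k, so that P a 0 = x^a. The identity
-- [a] P a k = [k] P a k + x q^k [k+1] P a (k+1) turns the recurrence of S into a Stieltjes
-- recurrence, with lam k = x q^k [k+1] for φ n and lam k = x q^(k+1) [k+1] for φ (n+1) / x.
-- Then Λ k = x^k q^C(k,2) [k]! (respectively x^k q^C(k+1,2) [k]!), and multiplying these
-- monomials produces the binomial exponents.
module Submission where

open import Level using (Level)
open import Function using (_∘_)
open import Data.Nat.Base as ℕ using (ℕ; zero; suc)
import Data.Nat.Properties as ℕ
open import Data.Nat.Combinatorics using (_C_; nC1≡n; nCk+nC[k+1]≡[n+1]C[k+1])
open import Data.Fin.Base using (Fin; zero; suc; toℕ; punchIn; punchOut; inject₁; fromℕ<)
import Data.Fin.Properties as FinP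
open FinP using (_≟_)
open import Data.Sum.Base using (_⊎_; inj₁; inj₂)
open import Data.Product.Base using (_×_; _,_)
open import Data.Empty using (⊥-elim)
open import Relation.Nullary using (yes; no; ¬_)
open import Relation.Binary.Definitions using (tri<; tri≈; tri>)
import Relation.Binary.PropositionalEquality as ≡
open ≡ using (_≡_; _≢_)
open import Algebra.Bundles using (CommutativeRing)
open import Defs

data Adjacent : ∀ {n} → Fin n → Fin n → Set where
  zero-one : ∀ {n} → Adjacent {suc (suc n)} zero (suc zero)
  suc-suc  : ∀ {n} {a b : Fin n} → Adjacent a b → Adjacent (suc a) (suc b)

Adjacent⇒toℕ-suc : ∀ {n} {a b : Fin n} → Adjacent a b → toℕ b ≡ suc (toℕ a)
Adjacent⇒toℕ-suc zero-one    = ≡.refl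
Adjacent⇒toℕ-suc (suc-suc p) = ≡.cong suc (Adjacent⇒toℕ-suc p)

toℕ-suc⇒Adjacent : ∀ {n} {a b : Fin n} → toℕ b ≡ suc (toℕ a) → Adjacent a b
toℕ-suc⇒Adjacent {a = zero}  {b = suc zero}    _  = zero-one
toℕ-suc⇒Adjacent {a = zero}  {b = suc (suc _)} ()
toℕ-suc⇒Adjacent {a = suc a} {b = suc b}       eq = suc-suc (toℕ-suc⇒Adjacent (ℕ.suc-injective eq))

Adjacent⇒≢ : ∀ {n} {a b : Fin n} → Adjacent a b → a ≢ b
Adjacent⇒≢ (suc-suc p) ≡.refl = Adjacent⇒≢ p ≡.refl

Adjacent-inject₁-suc : ∀ {n} (i : Fin n) → Adjacent (inject₁ i) (suc i)
Adjacent-inject₁-suc zero    = zero-one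
Adjacent-inject₁-suc (suc i) = suc-suc (Adjacent-inject₁-suc i)

Adjacent-punchOut : ∀ {n} {j a b : Fin (suc n)} (j≢a : j ≢ a) (j≢b : j ≢ b) →
                    Adjacent a b → Adjacent (punchOut j≢a) (punchOut j≢b)
Adjacent-punchOut {j = zero}     j≢a j≢b zero-one = ⊥-elim (j≢a ≡.refl)
Adjacent-punchOut {j = suc zero} j≢a j≢b zero-one = ⊥-elim (j≢b ≡.refl)
Adjacent-punchOut {n = suc (suc n)} {j = suc (suc j)} j≢a j≢b zero-one = zero-one
Adjacent-punchOut {j = zero} j≢a j≢b (suc-suc p) = p
Adjacent-punchOut {n = suc n} {j = suc j} j≢a j≢b (suc-suc p) =
  suc-suc (Adjacent-punchOut (j≢a ∘ ≡.cong suc) (j≢b ∘ ≡.cong suc) p)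

Adjacent-punchIn : ∀ {n} {a b : Fin (suc n)} → Adjacent a b → ∀ s →
                   punchIn a s ≡ punchIn b s ⊎ (punchIn a s ≡ b × punchIn b s ≡ a)
Adjacent-punchIn zero-one    zero    = inj₂ (≡.refl , ≡.refl)
Adjacent-punchIn zero-one    (suc s) = inj₁ ≡.refl
Adjacent-punchIn (suc-suc p) zero    = inj₁ ≡.refl
Adjacent-punchIn (suc-suc p) (suc s) with Adjacent-punchIn p s
... | inj₁ eq          = inj₁ (≡.cong suc eq)
... | inj₂ (eqa , eqb) = inj₂ (≡.cong suc eqa , ≡.cong suc eqb)

suc-C-2 : ∀ k → suc k C 2 ≡ k ℕ.+ k C 2
suc-C-2 k = ≡.trans (≡.sym (nCk+nC[k+1]≡[n+1]C[k+1] k 1)) (≡.cong (ℕ._+ k C 2) (nC1≡n k))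

module _ {ℓ₁ ℓ₂ : Level} (R : CommutativeRing ℓ₁ ℓ₂) where

  open CommutativeRing R hiding (zero)
  open QStirling R
  open import Algebra.Properties.Ring ring using (-1*x≈-x)
  open import Algebra.Properties.Semiring.Sum semiring
    using (sum; sum-cong-≋; sum-replicate-zero; ∑-distrib-+; ∑-comm; *-distribˡ-sum; *-distribʳ-sum)
  open import Algebra.Properties.CommutativeMonoid.Sum *-commutativeMonoid
    using () renaming (sum to product; sum-cong-≋ to product-cong-≋; ∑-distrib-+ to product-distrib-*)
  open import Algebra.Solver.Ring.NaturalCoefficients.Default commutativeSemiring
    using (solve; _:+_; _:*_; _:=_; con)
  open import Relation.Binary.Reasoning.Setoid setoid

  -- Sums and products

  sumFin≡sum : ∀ n (f : Fin n → Carrier) → sumFin n f ≡ sum f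
  sumFin≡sum zero    f = ≡.refl
  sumFin≡sum (suc n) f = ≡.cong (f zero +_) (sumFin≡sum n (f ∘ suc))

  prodFin≡product : ∀ n (f : Fin n → Carrier) → prodFin n f ≡ product f
  prodFin≡product zero    f = ≡.refl
  prodFin≡product (suc n) f = ≡.cong (f zero *_) (prodFin≡product n (f ∘ suc))

  Σ-cong : ∀ n {f g : Fin n → Carrier} → (∀ i → f i ≈ g i) → sumFin n f ≈ sumFin n g
  Σ-cong n {f} {g} f≈g rewrite sumFin≡sum n f | sumFin≡sum n g = sum-cong-≋ f≈g

  Σ-+ : ∀ n (f g : Fin n → Carrier) → sumFin n (λ i → f i + g i) ≈ sumFin n f + sumFin n g
  Σ-+ n f g rewrite sumFin≡sum n f | sumFin≡sum n g | sumFin≡sum n (λ i → f i + g i) = ∑-distrib-+ f g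

  Σ-*ˡ : ∀ n a (f : Fin n → Carrier) → a * sumFin n f ≈ sumFin n (λ i → a * f i)
  Σ-*ˡ n a f rewrite sumFin≡sum n f | sumFin≡sum n (λ i → a * f i) = *-distribˡ-sum a f

  Σ-*ʳ : ∀ n a (f : Fin n → Carrier) → sumFin n f * a ≈ sumFin n (λ i → f i * a)
  Σ-*ʳ n a f rewrite sumFin≡sum n f | sumFin≡sum n (λ i → f i * a) = *-distribʳ-sum a f

  Σ-zero : ∀ n (f : Fin n → Carrier) → (∀ i → f i ≈ 0#) → sumFin n f ≈ 0#
  Σ-zero n f f≈0 rewrite sumFin≡sum n f = trans (sum-cong-≋ f≈0) (sum-replicate-zero n)

  Σ-comm : ∀ m n (f : Fin m → Fin n → Carrier) →
           sumFin m (λ i → sumFin n (f i)) ≈ sumFin n (λ j → sumFin m (λ i → f i j))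
  Σ-comm m n f = begin
    sumFin m (λ i → sumFin n (f i))          ≈⟨ Σ-cong m (λ i → reflexive (sumFin≡sum n (f i))) ⟩
    sumFin m (λ i → sum (f i))               ≡⟨ sumFin≡sum m _ ⟩
    sum (λ i → sum (f i))                    ≈⟨ ∑-comm f ⟩
    sum (λ j → sum (λ i → f i j))            ≡⟨ sumFin≡sum n _ ⟨
    sumFin n (λ j → sum (λ i → f i j))       ≈⟨ Σ-cong n (λ j → reflexive (sumFin≡sum m (λ i → f i j))) ⟨
    sumFin n (λ j → sumFin m (λ i → f i j))  ∎

  Σ-single : ∀ n (f : Fin n → Carrier) (s : Fin n) → (∀ i → i ≢ s → f i ≈ 0#) → sumFin n f ≈ f s
  Σ-single (suc n) f zero    f≈0 = trans (+-congˡ (Σ-zero n _ (λ i → f≈0 (suc i) λ ()))) (+-identityʳ _)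
  Σ-single (suc n) f (suc s) f≈0 =
    trans (+-cong (f≈0 zero λ ()) (Σ-single n _ s (λ i i≢s → f≈0 (suc i) (i≢s ∘ FinP.suc-injective))))
          (+-identityˡ _)

  Σ-pair : ∀ n (f : Fin n → Carrier) (a b : Fin n) → a ≢ b → (∀ i → i ≢ a → i ≢ b → f i ≈ 0#) →
           sumFin n f ≈ f a + f b
  Σ-pair (suc n) f zero    zero    a≢b f≈0 = ⊥-elim (a≢b ≡.refl)
  Σ-pair (suc n) f zero    (suc b) a≢b f≈0 =
    +-congˡ (Σ-single n _ b (λ i i≢b → f≈0 (suc i) (λ ()) (i≢b ∘ FinP.suc-injective)))
  Σ-pair (suc n) f (suc a) zero    a≢b f≈0 =
    trans (+-congˡ (Σ-single n _ a (λ i i≢a → f≈0 (suc i) (i≢a ∘ FinP.suc-injective) (λ ())))) (+-comm _ _)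
  Σ-pair (suc n) f (suc a) (suc b) a≢b f≈0 =
    trans (+-cong (f≈0 zero (λ ()) (λ ()))
                  (Σ-pair n _ a b (a≢b ∘ ≡.cong suc)
                          (λ i i≢a i≢b → f≈0 (suc i) (i≢a ∘ FinP.suc-injective) (i≢b ∘ FinP.suc-injective))))
          (+-identityˡ _)

  sumℕ : ℕ → (ℕ → Carrier) → Carrier
  sumℕ n f = sumFin n (f ∘ toℕ)

  Σ-lastℕ : ∀ n (f : ℕ → Carrier) → sumℕ (suc n) f ≈ sumℕ n f + f n
  Σ-lastℕ zero    f = trans (+-identityʳ _) (sym (+-identityˡ _))
  Σ-lastℕ (suc n) f = trans (+-congˡ (Σ-lastℕ n (f ∘ suc))) (sym (+-assoc _ _ _))

  Σ-dropLastℕ : ∀ n (f : ℕ → Carrier) → f n ≈ 0# → sumℕ (suc n) f ≈ sumℕ n f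
  Σ-dropLastℕ n f fₙ≈0 = trans (Σ-lastℕ n f) (trans (+-congˡ fₙ≈0) (+-identityʳ _))

  Σ-+₃ : ∀ n (f g h : ℕ → Carrier) →
         sumℕ n (λ k → f k + (g k + h k)) ≈ sumℕ n f + (sumℕ n g + sumℕ n h)
  Σ-+₃ n f g h = trans (Σ-+ n _ _) (+-congˡ (Σ-+ n (g ∘ toℕ) (h ∘ toℕ)))

  Π-cong : ∀ n {f g : Fin n → Carrier} → (∀ i → f i ≈ g i) → prodFin n f ≈ prodFin n g
  Π-cong n {f} {g} f≈g rewrite prodFin≡product n f | prodFin≡product n g = product-cong-≋ f≈g

  Π-* : ∀ n (f g : Fin n → Carrier) → prodFin n (λ i → f i * g i) ≈ prodFin n f * prodFin n g
  Π-* n f g rewrite prodFin≡product n f | prodFin≡product n g | prodFin≡product n (λ i → f i * g i) =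
    product-distrib-* f g

  Π-*₃ : ∀ n (f g h : Fin n → Carrier) →
         prodFin n (λ i → f i * (g i * h i)) ≈ prodFin n f * (prodFin n g * prodFin n h)
  Π-*₃ n f g h = trans (Π-* n f _) (*-congˡ (Π-* n g h))

  Π-lastℕ : ∀ n (f : ℕ → Carrier) → prodFin (suc n) (f ∘ toℕ) ≈ prodFin n (f ∘ toℕ) * f n
  Π-lastℕ zero    f = trans (*-identityʳ _) (sym (*-identityˡ _))
  Π-lastℕ (suc n) f = trans (*-congˡ (Π-lastℕ n (f ∘ suc))) (sym (*-assoc _ _ _))

  zeroʳ-≈ : ∀ x {y} → y ≈ 0# → x * y ≈ 0#
  zeroʳ-≈ x y≈0 = trans (*-congˡ y≈0) (zeroʳ x)

  zeroˡ-≈ : ∀ {x} y → x ≈ 0# → x * y ≈ 0#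
  zeroˡ-≈ y x≈0 = trans (*-congʳ x≈0) (zeroˡ y)

  pow-+ : ∀ a m n → pow a (m ℕ.+ n) ≈ pow a m * pow a n
  pow-+ a zero    n = sym (*-identityˡ _)
  pow-+ a (suc m) n = trans (*-congˡ (pow-+ a m n)) (sym (*-assoc _ _ _))

  Π-pow-choose : ∀ a r n → prodFin n (λ k → pow a (toℕ k C r)) ≈ pow a (n C suc r)
  Π-pow-choose a r zero    = refl
  Π-pow-choose a r (suc n) = begin
    prodFin (suc n) (λ k → pow a (toℕ k C r))            ≈⟨ Π-lastℕ n (λ k → pow a (k C r)) ⟩
    prodFin n (λ k → pow a (toℕ k C r)) * pow a (n C r)  ≈⟨ *-congʳ (Π-pow-choose a r n) ⟩
    pow a (n C suc r) * pow a (n C r)                    ≈⟨ *-comm _ _ ⟩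
    pow a (n C r) * pow a (n C suc r)                    ≈⟨ pow-+ a (n C r) (n C suc r) ⟨
    pow a (n C r ℕ.+ n C suc r)                          ≡⟨ ≡.cong (pow a) (nCk+nC[k+1]≡[n+1]C[k+1] n r) ⟩
    pow a (suc n C suc r)                                ∎

  Π-pow-id : ∀ a n → prodFin n (λ k → pow a (toℕ k)) ≈ pow a (n C 2)
  Π-pow-id a n =
    trans (Π-cong n (λ k → reflexive (≡.cong (pow a) (≡.sym (nC1≡n (toℕ k)))))) (Π-pow-choose a 1 n)

  -- Determinants

  Matrix : ℕ → Set ℓ₁
  Matrix n = Fin n → Fin n → Carrier

  minor : ∀ {n} → Matrix (suc n) → Fin (suc n) → Matrix n
  minor M j r s = M (suc r) (punchIn j s)

  laplaceTerm : ∀ {n} → Matrix (suc n) → Fin (suc n) → Carrier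
  laplaceTerm {n} M j = pow (- 1#) (toℕ j) * (M zero j * det n (minor M j))

  minor-punchOut : ∀ {n} (M : Matrix (suc n)) {j s} (j≢s : j ≢ s) i →
                   minor M j i (punchOut j≢s) ≡ M (suc i) s
  minor-punchOut M j≢s i = ≡.cong (M (suc i)) (FinP.punchIn-punchOut j≢s)

  punchIn-≢ : ∀ {n} {j s : Fin (suc n)} (j≢s : j ≢ s) {t} → t ≢ punchOut j≢s → punchIn j t ≢ s
  punchIn-≢ {j = j} j≢s {t} t≢ eq =
    t≢ (FinP.punchIn-injective j t _ (≡.trans eq (≡.sym (FinP.punchIn-punchOut j≢s))))

  det-cong : ∀ n {M N : Matrix n} → (∀ i j → M i j ≈ N i j) → det n M ≈ det n N
  det-cong zero    M≈N = refl
  det-cong (suc n) M≈N = Σ-cong (suc n) λ j →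
    *-congˡ {pow (- 1#) (toℕ j)} (*-cong (M≈N zero j) (det-cong n (λ r s → M≈N (suc r) (punchIn j s))))

  replaceCol : ∀ {n} → Matrix n → Fin n → (Fin n → Carrier) → Matrix n
  replaceCol M s u i j with j ≟ s
  ... | yes _ = u i
  ... | no  _ = M i j

  replaceCol-here : ∀ {n} (M : Matrix n) s u i → replaceCol M s u i s ≈ u i
  replaceCol-here M s u i with s ≟ s
  ... | yes _   = refl
  ... | no  s≢s = ⊥-elim (s≢s ≡.refl)

  replaceCol-there : ∀ {n} (M : Matrix n) s u i {j} → j ≢ s → replaceCol M s u i j ≈ M i j
  replaceCol-there M s u i {j} j≢s with j ≟ s
  ... | yes j≡s = ⊥-elim (j≢s j≡s)
  ... | no  _   = refl

  replaceCol-self : ∀ {n} (M : Matrix n) s i j → replaceCol M s (λ i → M i s) i j ≈ M i j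
  replaceCol-self M s i j with j ≟ s
  ... | yes ≡.refl = refl
  ... | no  _      = refl

  det-linear-col : ∀ {n K} (X : Matrix n) (Q : Fin K → Matrix n) (w : Fin K → Carrier) (s : Fin n) →
    (∀ r i j → j ≢ s → X i j ≈ Q r i j) → (∀ i → X i s ≈ sumFin K (λ r → w r * Q r i s)) →
    det n X ≈ sumFin K (λ r → w r * det n (Q r))
  det-linear-col {suc n} {K} X Q w s X≈Q X≈ΣQ = begin
    sumFin (suc n) (laplaceTerm X)
      ≈⟨ Σ-cong (suc n) expand ⟩
    sumFin (suc n) (λ j → sumFin K (λ r → w r * laplaceTerm (Q r) j))
      ≈⟨ Σ-comm (suc n) K (λ j r → w r * laplaceTerm (Q r) j) ⟩
    sumFin K (λ r → sumFin (suc n) (λ j → w r * laplaceTerm (Q r) j))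
      ≈⟨ Σ-cong K (λ r → Σ-*ˡ (suc n) (w r) (laplaceTerm (Q r))) ⟨
    sumFin K (λ r → w r * det (suc n) (Q r))
      ∎
    where
    expand : ∀ j → laplaceTerm X j ≈ sumFin K (λ r → w r * laplaceTerm (Q r) j)
    expand j with j ≟ s
    ... | yes ≡.refl = begin
      ε * (X zero j * D)                             ≈⟨ *-congˡ (*-congʳ (X≈ΣQ zero)) ⟩
      ε * (sumFin K (λ r → w r * Q r zero j) * D)    ≈⟨ *-congˡ (Σ-*ʳ K D _) ⟩
      ε * sumFin K (λ r → (w r * Q r zero j) * D)    ≈⟨ Σ-*ˡ K ε _ ⟩
      sumFin K (λ r → ε * ((w r * Q r zero j) * D))  ≈⟨ Σ-cong K regroup ⟩
      sumFin K (λ r → w r * laplaceTerm (Q r) j)     ∎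
      where
      ε = pow (- 1#) (toℕ j)
      D = det n (minor X j)
      minors-agree : ∀ r → D ≈ det n (minor (Q r) j)
      minors-agree r = det-cong n (λ a t → X≈Q r (suc a) (punchIn j t) (FinP.punchInᵢ≢i j t))
      regroup : ∀ r → ε * ((w r * Q r zero j) * D) ≈ w r * laplaceTerm (Q r) j
      regroup r = trans (solve 4 (λ ε w x d → (ε :* ((w :* x) :* d)) := (w :* (ε :* (x :* d)))) refl ε (w r) (Q r zero j) D)
                        (*-congˡ (*-congˡ (*-congˡ (minors-agree r))))
    ... | no j≢s = begin
      ε * (X zero j * det n (minor X j))                                ≈⟨ *-congˡ (*-congˡ minor-linear) ⟩
      ε * (X zero j * sumFin K (λ r → w r * Dᵣ r))                       ≈⟨ *-congˡ (Σ-*ˡ K _ _) ⟩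
      ε * sumFin K (λ r → X zero j * (w r * Dᵣ r))                       ≈⟨ Σ-*ˡ K ε _ ⟩
      sumFin K (λ r → ε * (X zero j * (w r * Dᵣ r)))                     ≈⟨ Σ-cong K regroup ⟩
      sumFin K (λ r → w r * laplaceTerm (Q r) j)                         ∎
      where
      ε = pow (- 1#) (toℕ j)
      Dᵣ : Fin K → Carrier
      Dᵣ r = det n (minor (Q r) j)
      regroup : ∀ r → ε * (X zero j * (w r * Dᵣ r)) ≈ w r * laplaceTerm (Q r) j
      regroup r = trans (*-congˡ (*-congʳ (X≈Q r zero j j≢s)))
        (solve 4 (λ ε x w d → (ε :* (x :* (w :* d))) := (w :* (ε :* (x :* d)))) refl ε (Q r zero j) (w r) (Dᵣ r))
      minor-linear : det n (minor X j) ≈ sumFin K (λ r → w r * Dᵣ r)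
      minor-linear = det-linear-col (minor X j) (λ r → minor (Q r) j) w (punchOut j≢s)
        (λ r a t t≢ → X≈Q r (suc a) (punchIn j t) (punchIn-≢ j≢s t≢))
        (λ a → begin
          minor X j a (punchOut j≢s)                             ≡⟨ minor-punchOut X j≢s a ⟩
          X (suc a) s                                            ≈⟨ X≈ΣQ (suc a) ⟩
          sumFin K (λ r → w r * Q r (suc a) s)
            ≈⟨ Σ-cong K (λ r → *-congˡ (reflexive (≡.sym (minor-punchOut (Q r) j≢s a)))) ⟩
          sumFin K (λ r → w r * minor (Q r) j a (punchOut j≢s))  ∎)

  det-additive-col : ∀ {n} (X Y Z : Matrix n) (s : Fin n) →
    (∀ i j → j ≢ s → X i j ≈ Y i j) → (∀ i j → j ≢ s → X i j ≈ Z i j) →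
    (∀ i → X i s ≈ Y i s + Z i s) → det n X ≈ det n Y + det n Z
  det-additive-col {n} X Y Z s X≈Y X≈Z X≈Y+Z =
    trans (det-linear-col X Q (λ _ → 1#) s X≈Q (λ i → trans (X≈Y+Z i) (sym (unit-weights (Y i s) (Z i s)))))
          (unit-weights (det n Y) (det n Z))
    where
    Q : Fin 2 → Matrix n
    Q zero    = Y
    Q (suc _) = Z
    X≈Q : ∀ r i j → j ≢ s → X i j ≈ Q r i j
    X≈Q zero       = X≈Y
    X≈Q (suc zero) = X≈Z
    unit-weights : ∀ y z → 1# * y + (1# * z + 0#) ≈ y + z
    unit-weights = solve 2 (λ y z → (con 1 :* y :+ (con 1 :* z :+ con 0)) := (y :+ z)) refl

  det-adjacent-equal-cols : ∀ {n} (M : Matrix n) {a b : Fin n} → Adjacent a b →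
                            (∀ i → M i a ≈ M i b) → det n M ≈ 0#
  det-adjacent-equal-cols {suc n} M {a} {b} adj Ma≈Mb = begin
    sumFin (suc n) (laplaceTerm M)
      ≈⟨ Σ-pair (suc n) (laplaceTerm M) a b (Adjacent⇒≢ adj) others-vanish ⟩
    laplaceTerm M a + laplaceTerm M b            ≈⟨ +-congˡ (trans b-term (-1*x≈-x _)) ⟩
    laplaceTerm M a - laplaceTerm M a            ≈⟨ -‿inverseʳ _ ⟩
    0#                                           ∎
    where
    minors-agree : ∀ r t → minor M b r t ≈ minor M a r t
    minors-agree r t with Adjacent-punchIn adj t
    ... | inj₁ eq          = reflexive (≡.cong (M (suc r)) (≡.sym eq))
    ... | inj₂ (eqa , eqb) = trans (reflexive (≡.cong (M (suc r)) eqb))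
                                   (trans (Ma≈Mb (suc r)) (reflexive (≡.cong (M (suc r)) (≡.sym eqa))))
    b-term : laplaceTerm M b ≈ (- 1#) * laplaceTerm M a
    b-term = trans (*-cong (reflexive (≡.cong (pow (- 1#)) (Adjacent⇒toℕ-suc adj)))
                           (*-cong (sym (Ma≈Mb zero)) (det-cong n minors-agree)))
                   (*-assoc _ _ _)
    others-vanish : ∀ j → j ≢ a → j ≢ b → laplaceTerm M j ≈ 0#
    others-vanish j j≢a j≢b = zeroʳ-≈ _ (zeroʳ-≈ _
      (det-adjacent-equal-cols (minor M j) (Adjacent-punchOut j≢a j≢b adj) λ i → begin
        minor M j i (punchOut j≢a)  ≡⟨ minor-punchOut M j≢a i ⟩
        M (suc i) a                 ≈⟨ Ma≈Mb (suc i) ⟩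
        M (suc i) b                 ≡⟨ minor-punchOut M j≢b i ⟨
        minor M j i (punchOut j≢b)  ∎))

  alternating⇒antisymmetric : ∀ {a} {V : Set a} (_⊕_ : V → V → V) (D : V → V → Carrier) →
    (∀ u v w → D (u ⊕ v) w ≈ D u w + D v w) → (∀ u v w → D u (v ⊕ w) ≈ D u v + D u w) →
    (∀ u → D u u ≈ 0#) → ∀ u v → D u v + D v u ≈ 0#
  alternating⇒antisymmetric _⊕_ D additiveˡ additiveʳ alternating u v = begin
    D u v + D v u                      ≈⟨ +-cong (+-identityˡ _) (+-identityʳ _) ⟨
    (0# + D u v) + (D v u + 0#)        ≈⟨ +-cong (+-congʳ (alternating u)) (+-congˡ (alternating v)) ⟨
    (D u u + D u v) + (D v u + D v v)  ≈⟨ +-cong (additiveʳ u u v) (additiveʳ v u v) ⟨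
    D u (u ⊕ v) + D v (u ⊕ v)          ≈⟨ additiveˡ u v (u ⊕ v) ⟨
    D (u ⊕ v) (u ⊕ v)                  ≈⟨ alternating (u ⊕ v) ⟩
    0#                                 ∎

  replaceCols : ∀ {n} → Matrix n → Fin n → Fin n → (u v : Fin n → Carrier) → Matrix n
  replaceCols M a b u v = replaceCol (replaceCol M b v) a u

  replaceCols-self : ∀ {n} (M : Matrix n) a b i j → replaceCols M a b (λ i → M i a) (λ i → M i b) i j ≈ M i j
  replaceCols-self M a b i j with j ≟ a
  ... | yes ≡.refl = refl
  ... | no  _      = replaceCol-self M b i j

  det-swap-adjacent-cols : ∀ {n} (M : Matrix n) {a b : Fin n} → Adjacent a b → ∀ u v →
    det n (replaceCols M a b u v) + det n (replaceCols M a b v u) ≈ 0#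
  det-swap-adjacent-cols {n} M {a} {b} adj =
    alternating⇒antisymmetric (λ u v i → u i + v i) D additiveˡ additiveʳ alternating
    where
    a≢b = Adjacent⇒≢ adj
    D : (u v : Fin n → Carrier) → Carrier
    D u v = det n (replaceCols M a b u v)
    col-a : ∀ u v i → replaceCols M a b u v i a ≈ u i
    col-a u v i = replaceCol-here _ a u i
    col-b : ∀ u v i → replaceCols M a b u v i b ≈ v i
    col-b u v i = trans (replaceCol-there _ a u i (a≢b ∘ ≡.sym)) (replaceCol-here M b v i)
    off-a : ∀ u u′ v i j → j ≢ a → replaceCols M a b u v i j ≈ replaceCols M a b u′ v i j
    off-a u u′ v i j j≢a = trans (replaceCol-there _ a u i j≢a) (sym (replaceCol-there _ a u′ i j≢a))
    off-b : ∀ u v v′ i j → j ≢ b → replaceCols M a b u v i j ≈ replaceCols M a b u v′ i j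
    off-b u v v′ i j j≢b with j ≟ a
    ... | yes _ = refl
    ... | no  _ = trans (replaceCol-there M b v i j≢b) (sym (replaceCol-there M b v′ i j≢b))
    additiveˡ : ∀ u v w → D (λ i → u i + v i) w ≈ D u w + D v w
    additiveˡ u v w = det-additive-col _ _ _ a (off-a _ u w) (off-a _ v w)
      (λ i → trans (col-a _ w i) (sym (+-cong (col-a u w i) (col-a v w i))))
    additiveʳ : ∀ u v w → D u (λ i → v i + w i) ≈ D u v + D u w
    additiveʳ u v w = det-additive-col _ _ _ b (off-b u _ v) (off-b u _ w)
      (λ i → trans (col-b u _ i) (sym (+-cong (col-b u v i) (col-b u w i))))
    alternating : ∀ u → D u u ≈ 0#
    alternating u = det-adjacent-equal-cols _ adj (λ i → trans (col-a u u i) (sym (col-b u u i)))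

  -- Swapping the right column with its left neighbour moves the two equal columns
  -- closer together and only changes the sign.
  det-equal-cols-at-distance : ∀ d {n} (M : Matrix n) {a b : Fin n} → toℕ b ≡ d ℕ.+ suc (toℕ a) →
                               (∀ i → M i a ≈ M i b) → det n M ≈ 0#
  det-equal-cols-at-distance zero M b≡1+a Ma≈Mb =
    det-adjacent-equal-cols M (toℕ-suc⇒Adjacent b≡1+a) Ma≈Mb
  det-equal-cols-at-distance (suc d) {suc n} M {a} {suc b} b≡d+1+a Ma≈Mb = begin
    det (suc n) M                         ≈⟨ det-cong (suc n) (replaceCols-self M b′ (suc b)) ⟨
    det (suc n) unswapped                 ≈⟨ +-identityʳ _ ⟨
    det (suc n) unswapped + 0#            ≈⟨ +-congˡ swapped-vanishes ⟨
    det (suc n) unswapped + det (suc n) swapped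
                                          ≈⟨ det-swap-adjacent-cols M (Adjacent-inject₁-suc b) u v ⟩
    0#                                    ∎
    where
    b′ = inject₁ b
    u v : Fin (suc n) → Carrier
    u i = M i b′
    v i = M i (suc b)
    unswapped = replaceCols M b′ (suc b) u v
    swapped   = replaceCols M b′ (suc b) v u
    b′≡d+1+a : toℕ b′ ≡ d ℕ.+ suc (toℕ a)
    b′≡d+1+a = ≡.trans (FinP.toℕ-inject₁ b) (ℕ.suc-injective b≡d+1+a)
    a≢b′ : a ≢ b′
    a≢b′ a≡b′ = ℕ.m+1+n≢n d (≡.sym (≡.trans (≡.cong toℕ a≡b′) b′≡d+1+a))
    a≢b : a ≢ suc b
    a≢b a≡b = ℕ.m+1+n≢n (suc d) (≡.sym (≡.trans (≡.cong toℕ a≡b) b≡d+1+a))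
    swapped-vanishes : det (suc n) swapped ≈ 0#
    swapped-vanishes = det-equal-cols-at-distance d swapped b′≡d+1+a λ i → begin
      swapped i a  ≈⟨ replaceCol-there _ b′ v i a≢b′ ⟩
      _            ≈⟨ replaceCol-there M (suc b) u i a≢b ⟩
      M i a        ≈⟨ Ma≈Mb i ⟩
      M i (suc b)  ≈⟨ replaceCol-here _ b′ v i ⟨
      swapped i b′ ∎

  det-equal-cols : ∀ {n} (M : Matrix n) {a b : Fin n} → a ≢ b → (∀ i → M i a ≈ M i b) → det n M ≈ 0#
  det-equal-cols M {a} {b} a≢b Ma≈Mb with ℕ.<-cmp (toℕ a) (toℕ b)
  ... | tri< a<b _ _ = det-equal-cols-at-distance _ M (≡.sym (ℕ.m∸n+n≡m a<b)) Ma≈Mb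
  ... | tri≈ _ a≡b _ = ⊥-elim (a≢b (FinP.toℕ-injective a≡b))
  ... | tri> _ _ b<a = det-equal-cols-at-distance _ M (≡.sym (ℕ.m∸n+n≡m b<a)) (sym ∘ Ma≈Mb)

  det-add-combination-to-col : ∀ {n} (M : Matrix n) (s : Fin n) (v : Fin n → Carrier) → v s ≈ 1# →
    det n (replaceCol M s (λ i → sumFin n (λ r → v r * M i r))) ≈ det n M
  det-add-combination-to-col {n} M s v vₛ≈1 = begin
    det n (replaceCol M s _)             ≈⟨ det-linear-col _ Q v s off-s at-s ⟩
    sumFin n (λ r → v r * det n (Q r))   ≈⟨ Σ-single n _ s others-vanish ⟩
    v s * det n (Q s)                    ≈⟨ *-cong vₛ≈1 (det-cong n (replaceCol-self M s)) ⟩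
    1# * det n M                         ≈⟨ *-identityˡ _ ⟩
    det n M                              ∎
    where
    Q : Fin n → Matrix n
    Q r = replaceCol M s (λ i → M i r)
    off-s : ∀ r i j → j ≢ s → replaceCol M s _ i j ≈ Q r i j
    off-s r i j j≢s = trans (replaceCol-there M s _ i j≢s) (sym (replaceCol-there M s _ i j≢s))
    at-s : ∀ i → replaceCol M s _ i s ≈ sumFin n (λ r → v r * Q r i s)
    at-s i = trans (replaceCol-here M s _ i) (Σ-cong n (λ r → *-congˡ (sym (replaceCol-here M s _ i))))
    others-vanish : ∀ r → r ≢ s → v r * det n (Q r) ≈ 0#
    others-vanish r r≢s = zeroʳ-≈ _ (det-equal-cols (Q r) r≢s λ i →
      trans (replaceCol-there M s _ i r≢s) (sym (replaceCol-here M s _ i)))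

  det-lowerTriangular : ∀ {n} (M : Matrix n) → (∀ i j → toℕ i ℕ.< toℕ j → M i j ≈ 0#) →
                        det n M ≈ prodFin n (λ i → M i i)
  det-lowerTriangular {zero}  M upper≈0 = refl
  det-lowerTriangular {suc n} M upper≈0 = begin
    laplaceTerm M zero + sumFin n (λ j → laplaceTerm M (suc j))
      ≈⟨ +-congˡ (Σ-zero n _ (λ j → zeroʳ-≈ _ (zeroˡ-≈ _ (upper≈0 zero (suc j) (ℕ.s≤s ℕ.z≤n))))) ⟩
    1# * (M zero zero * det n (minor M zero)) + 0#
      ≈⟨ trans (+-identityʳ _) (*-identityˡ _) ⟩
    M zero zero * det n (minor M zero)
      ≈⟨ *-congˡ (det-lowerTriangular (minor M zero) (λ i j i<j → upper≈0 (suc i) (suc j) (ℕ.s<s i<j))) ⟩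
    prodFin (suc n) (λ i → M i i)
      ∎

  det-*-unitriangular : ∀ {n} (M V H : Matrix n) →
    (∀ r s → toℕ s ℕ.< toℕ r → V r s ≈ 0#) → (∀ s → V s s ≈ 1#) →
    (∀ i j → H i j ≈ sumFin n (λ r → M i r * V r j)) → det n H ≈ det n M
  det-*-unitriangular {n} M V H lower≈0 diag≈1 H≈MV = begin
    det n H          ≈⟨ det-cong n (λ i j → sym (mixed-high 0 i j λ ())) ⟩
    det n (mixed 0)  ≈⟨ sweep n ℕ.≤-refl ⟩
    det n (mixed n)  ≈⟨ det-cong n (λ i j → mixed-low n i j (FinP.toℕ<n j)) ⟩
    det n M          ∎
    where
    mixed : ℕ → Matrix n
    mixed k i j with toℕ j ℕ.<? k
    ... | yes _ = M i j
    ... | no  _ = H i j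

    mixed-low : ∀ k i j → toℕ j ℕ.< k → mixed k i j ≈ M i j
    mixed-low k i j j<k with toℕ j ℕ.<? k
    ... | yes _   = refl
    ... | no  j≮k = ⊥-elim (j≮k j<k)

    mixed-high : ∀ k i j → ¬ toℕ j ℕ.< k → mixed k i j ≈ H i j
    mixed-high k i j j≮k with toℕ j ℕ.<? k
    ... | yes j<k = ⊥-elim (j≮k j<k)
    ... | no  _   = refl

    -- As V is unitriangular, column k of H is column k of M plus a combination of
    -- the earlier columns of M.
    sweep-step : ∀ k (k<n : k ℕ.< n) → det n (mixed k) ≈ det n (mixed (suc k))
    sweep-step k k<n = trans (det-cong n as-column-operation)
                             (det-add-combination-to-col (mixed (suc k)) s (λ r → V r s) (diag≈1 s))
      where
      s = fromℕ< k<n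
      s≡k : toℕ s ≡ k
      s≡k = FinP.toℕ-fromℕ< k<n
      same-column : ∀ i r → M i r * V r s ≈ V r s * mixed (suc k) i r
      same-column i r with toℕ r ℕ.<? suc k
      ... | yes _   = *-comm _ _
      ... | no  r≮s = trans (zeroʳ-≈ _ V≈0) (sym (zeroˡ-≈ _ V≈0))
        where
        V≈0 : V r s ≈ 0#
        V≈0 = lower≈0 r s (≡.subst (ℕ._< toℕ r) (≡.sym s≡k) (ℕ.≰⇒> (r≮s ∘ ℕ.s≤s)))
      as-column-operation : ∀ i j →
        mixed k i j ≈ replaceCol (mixed (suc k)) s (λ i → sumFin n (λ r → V r s * mixed (suc k) i r)) i j
      as-column-operation i j with j ≟ s
      ... | yes ≡.refl =
        trans (mixed-high k i s (ℕ.<-irrefl s≡k)) (trans (H≈MV i s) (Σ-cong n (same-column i)))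
      ... | no  j≢s with toℕ j ℕ.<? k | toℕ j ℕ.<? suc k
      ...   | yes _   | yes _   = refl
      ...   | no  _   | no  _   = refl
      ...   | yes j<k | no  j≮k = ⊥-elim (j≮k (ℕ.m<n⇒m<1+n j<k))
      ...   | no  j≮k | yes j<k =
        ⊥-elim (j≢s (FinP.toℕ-injective (≡.trans (ℕ.≤∧≮⇒≡ (ℕ.s≤s⁻¹ j<k) j≮k) (≡.sym s≡k))))

    sweep : ∀ k → k ℕ.≤ n → det n (mixed 0) ≈ det n (mixed k)
    sweep zero    _   = refl
    sweep (suc k) k<n = trans (sweep k (ℕ.<⇒≤ k<n)) (sweep-step k k<n)

  -- Stieltjes tables

  shiftRow : (ℕ → Carrier) → ℕ → Carrier
  shiftRow f zero    = 0#
  shiftRow f (suc k) = f k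

  -- lam k is the down-step weight written λₖ₊₁ in continued-fraction notation.
  jacobi : (b lam : ℕ → Carrier) → (ℕ → Carrier) → ℕ → Carrier
  jacobi b lam f k = shiftRow f k + (b k * f k + lam k * f (suc k))

  Λ : (ℕ → Carrier) → ℕ → Carrier
  Λ lam zero    = 1#
  Λ lam (suc k) = lam k * Λ lam k

  pairing : (lam : ℕ → Carrier) → ℕ → (f g : ℕ → Carrier) → Carrier
  pairing lam N f g = sumℕ N (λ k → f k * (g k * Λ lam k))

  pairing-cong : ∀ lam N {f f′ g g′ : ℕ → Carrier} → (∀ k → f k ≈ f′ k) → (∀ k → g k ≈ g′ k) →
                 pairing lam N f g ≈ pairing lam N f′ g′
  pairing-cong lam N f≈f′ g≈g′ = Σ-cong N (λ k → *-cong (f≈f′ (toℕ k)) (*-congʳ (g≈g′ (toℕ k))))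

  -- The down steps of one side match the up steps of the other because
  -- Λ lam (suc k) = lam k * Λ lam k; the vanishing of f kills the boundary terms.
  jacobi-selfAdjoint : ∀ b lam N (f g : ℕ → Carrier) → f N ≈ 0# → f (suc N) ≈ 0# →
    pairing lam (suc N) (jacobi b lam f) g ≈ pairing lam (suc N) f (jacobi b lam g)
  jacobi-selfAdjoint b lam N f g fₙ≈0 fₙ₊₁≈0 = begin
    pairing lam (suc N) (jacobi b lam f) g                 ≈⟨ Σ-cong (suc N) (expandˡ ∘ toℕ) ⟩
    sumℕ (suc N) (λ k → F₁ k + (F₂ k + F₃ k))              ≈⟨ Σ-+₃ (suc N) F₁ F₂ F₃ ⟩
    sumℕ (suc N) F₁ + (sumℕ (suc N) F₂ + sumℕ (suc N) F₃)
                                                           ≈⟨ +-cong F₁≈G₃ (+-cong (Σ-cong (suc N) (level ∘ toℕ)) F₃≈G₁) ⟩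
    sumℕ (suc N) G₃ + (sumℕ (suc N) G₂ + sumℕ (suc N) G₁)  ≈⟨ rotate _ _ _ ⟩
    sumℕ (suc N) G₁ + (sumℕ (suc N) G₂ + sumℕ (suc N) G₃)  ≈⟨ Σ-+₃ (suc N) G₁ G₂ G₃ ⟨
    sumℕ (suc N) (λ k → G₁ k + (G₂ k + G₃ k))              ≈⟨ Σ-cong (suc N) (expandʳ ∘ toℕ) ⟨
    pairing lam (suc N) f (jacobi b lam g)                 ∎
    where
    F₁ F₂ F₃ G₁ G₂ G₃ : ℕ → Carrier
    F₁ k = shiftRow f k * (g k * Λ lam k)
    F₂ k = (b k * f k) * (g k * Λ lam k)
    F₃ k = (lam k * f (suc k)) * (g k * Λ lam k)
    G₁ k = f k * (shiftRow g k * Λ lam k)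
    G₂ k = f k * ((b k * g k) * Λ lam k)
    G₃ k = f k * ((lam k * g (suc k)) * Λ lam k)
    expandˡ : ∀ k → jacobi b lam f k * (g k * Λ lam k) ≈ F₁ k + (F₂ k + F₃ k)
    expandˡ k = solve 4 (λ s x y w → ((s :+ (x :+ y)) :* w) := (s :* w :+ (x :* w :+ y :* w))) refl
      (shiftRow f k) (b k * f k) (lam k * f (suc k)) (g k * Λ lam k)
    expandʳ : ∀ k → f k * (jacobi b lam g k * Λ lam k) ≈ G₁ k + (G₂ k + G₃ k)
    expandʳ k = solve 5 (λ f s x y w → (f :* ((s :+ (x :+ y)) :* w))
                                       := (f :* (s :* w) :+ (f :* (x :* w) :+ f :* (y :* w)))) refl
      (f k) (shiftRow g k) (b k * g k) (lam k * g (suc k)) (Λ lam k)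
    level : ∀ k → F₂ k ≈ G₂ k
    level k = solve 4 (λ b f g w → ((b :* f) :* (g :* w)) := (f :* ((b :* g) :* w))) refl
      (b k) (f k) (g k) (Λ lam k)
    down : ∀ k → f k * (g (suc k) * Λ lam (suc k)) ≈ G₃ k
    down k = solve 4 (λ f g l w → (f :* (g :* (l :* w))) := (f :* ((l :* g) :* w))) refl
      (f k) (g (suc k)) (lam k) (Λ lam k)
    up : ∀ k → F₃ k ≈ f (suc k) * (g k * Λ lam (suc k))
    up k = solve 4 (λ l f g w → ((l :* f) :* (g :* w)) := (f :* (g :* (l :* w)))) refl
      (lam k) (f (suc k)) (g k) (Λ lam k)
    rotate : ∀ x y z → x + (y + z) ≈ z + (y + x)
    rotate = solve 3 (λ x y z → (x :+ (y :+ z)) := (z :+ (y :+ x))) refl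
    F₁≈G₃ : sumℕ (suc N) F₁ ≈ sumℕ (suc N) G₃
    F₁≈G₃ = begin
      0# * (g 0 * 1#) + sumℕ N (λ k → f k * (g (suc k) * Λ lam (suc k)))
        ≈⟨ trans (+-congʳ (zeroˡ _)) (+-identityˡ _) ⟩
      sumℕ N (λ k → f k * (g (suc k) * Λ lam (suc k)))
        ≈⟨ Σ-cong N (down ∘ toℕ) ⟩
      sumℕ N G₃
        ≈⟨ Σ-dropLastℕ N G₃ (zeroˡ-≈ _ fₙ≈0) ⟨
      sumℕ (suc N) G₃
        ∎
    F₃≈G₁ : sumℕ (suc N) F₃ ≈ sumℕ (suc N) G₁
    F₃≈G₁ = begin
      sumℕ (suc N) F₃
        ≈⟨ Σ-dropLastℕ N F₃ (zeroˡ-≈ _ (zeroʳ-≈ _ fₙ₊₁≈0)) ⟩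
      sumℕ N F₃
        ≈⟨ Σ-cong N (up ∘ toℕ) ⟩
      sumℕ N (λ k → f (suc k) * (g k * Λ lam (suc k)))
        ≈⟨ trans (+-congʳ (zeroʳ-≈ _ (zeroˡ _))) (+-identityˡ _) ⟨
      sumℕ (suc N) G₁
        ∎

  jacobi-linear : ∀ b lam n (w : ℕ → Carrier) (F : ℕ → ℕ → Carrier) k →
    sumℕ n (λ a → w a * jacobi b lam (F a) k) ≈ jacobi b lam (λ j → sumℕ n (λ a → w a * F a j)) k
  jacobi-linear b lam n w F k = begin
    sumℕ n (λ a → w a * jacobi b lam (F a) k)
      ≈⟨ Σ-cong n (expand ∘ toℕ) ⟩
    sumℕ n (λ a → w a * shiftRow (F a) k + (b k * (w a * F a k) + lam k * (w a * F a (suc k))))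
      ≈⟨ Σ-+₃ n (λ a → w a * shiftRow (F a) k) (λ a → b k * (w a * F a k)) (λ a → lam k * (w a * F a (suc k))) ⟩
    sumℕ n (λ a → w a * shiftRow (F a) k)
      + (sumℕ n (λ a → b k * (w a * F a k)) + sumℕ n (λ a → lam k * (w a * F a (suc k))))
      ≈⟨ +-cong (shift k) (+-cong (Σ-*ˡ n (b k) _) (Σ-*ˡ n (lam k) _)) ⟨
    jacobi b lam (λ j → sumℕ n (λ a → w a * F a j)) k
      ∎
    where
    expand : ∀ a → w a * jacobi b lam (F a) k
                 ≈ w a * shiftRow (F a) k + (b k * (w a * F a k) + lam k * (w a * F a (suc k)))
    expand a = solve 6 (λ w s b f l f′ → (w :* (s :+ (b :* f :+ l :* f′)))
                                         := (w :* s :+ (b :* (w :* f) :+ l :* (w :* f′)))) refl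
      (w a) (shiftRow (F a) k) (b k) (F a k) (lam k) (F a (suc k))
    shift : ∀ k → shiftRow (λ j → sumℕ n (λ a → w a * F a j)) k ≈ sumℕ n (λ a → w a * shiftRow (F a) k)
    shift zero    = sym (Σ-zero n _ (λ a → zeroʳ _))
    shift (suc k) = refl

  record IsStieltjesTable (b lam : ℕ → Carrier) (L : ℕ → ℕ → Carrier) : Set ℓ₂ where
    field
      initial-diag : L 0 0 ≈ 1#
      initial-off  : ∀ k → L 0 (suc k) ≈ 0#
      recurrence   : ∀ n k → L (suc n) k ≈ jacobi b lam (L n) k

  module StieltjesTable {b lam : ℕ → Carrier} {L : ℕ → ℕ → Carrier} (table : IsStieltjesTable b lam L) where
    open IsStieltjesTable table

    upper-vanishes : ∀ n k → n ℕ.< k → L n k ≈ 0#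
    upper-vanishes zero    (suc k) _       = initial-off k
    upper-vanishes (suc n) (suc k) n+1<k+1 = begin
      L (suc n) (suc k)
        ≈⟨ recurrence n (suc k) ⟩
      L n k + (b (suc k) * L n (suc k) + lam (suc k) * L n (suc (suc k)))
        ≈⟨ +-cong (vanish n<k) (+-cong (zeroʳ-≈ _ (vanish n<k+1)) (zeroʳ-≈ _ (vanish n<k+2))) ⟩
      0# + (0# + 0#)
        ≈⟨ trans (+-identityˡ _) (+-identityˡ _) ⟩
      0#
        ∎
      where
      vanish : ∀ {k} → n ℕ.< k → L n k ≈ 0#
      vanish = upper-vanishes n _
      n<k   = ℕ.s<s⁻¹ n+1<k+1
      n<k+1 = ℕ.m<n⇒m<1+n n<k
      n<k+2 = ℕ.m<n⇒m<1+n n<k+1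

    diagonal : ∀ n → L n n ≈ 1#
    diagonal zero    = initial-diag
    diagonal (suc n) = begin
      L (suc n) (suc n)
        ≈⟨ recurrence n (suc n) ⟩
      L n n + (b (suc n) * L n (suc n) + lam (suc n) * L n (suc (suc n)))
        ≈⟨ +-cong (diagonal n) (+-cong (zeroʳ-≈ _ (upper-vanishes n _ n<n+1))
                                       (zeroʳ-≈ _ (upper-vanishes n _ (ℕ.m<n⇒m<1+n n<n+1)))) ⟩
      1# + (0# + 0#)
        ≈⟨ trans (+-congˡ (+-identityˡ _)) (+-identityʳ _) ⟩
      1#
        ∎
      where
      n<n+1 = ℕ.n<1+n n

    hankel-pairing : ∀ N i j → i ℕ.< N → L (i ℕ.+ j) 0 ≈ pairing lam N (L i) (L j)
    hankel-pairing (suc N) zero j _ = sym (begin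
      L 0 0 * (L j 0 * 1#) + sumℕ N (λ k → L 0 (suc k) * (L j (suc k) * Λ lam (suc k)))
        ≈⟨ +-cong (*-cong initial-diag (*-identityʳ _)) (Σ-zero N _ (λ k → zeroˡ-≈ _ (initial-off (toℕ k)))) ⟩
      1# * L j 0 + 0#
        ≈⟨ trans (+-identityʳ _) (*-identityˡ _) ⟩
      L j 0
        ∎)
    hankel-pairing (suc N) (suc i) j i+1<N+1 = begin
      L (suc i ℕ.+ j) 0
        ≡⟨ ≡.cong (λ m → L m 0) (ℕ.+-suc i j) ⟨
      L (i ℕ.+ suc j) 0
        ≈⟨ hankel-pairing (suc N) i (suc j) i<N+1 ⟩
      pairing lam (suc N) (L i) (L (suc j))
        ≈⟨ pairing-cong lam (suc N) {L i} (λ _ → refl) (recurrence j) ⟩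
      pairing lam (suc N) (L i) (jacobi b lam (L j))
        ≈⟨ jacobi-selfAdjoint b lam N (L i) (L j) (upper-vanishes i N i<N) (upper-vanishes i (suc N) i<N+1) ⟨
      pairing lam (suc N) (jacobi b lam (L i)) (L j)
        ≈⟨ pairing-cong lam (suc N) {g = L j} (λ k → sym (recurrence i k)) (λ _ → refl) ⟩
      pairing lam (suc N) (L (suc i)) (L j)
        ∎
      where
      i<N   = ℕ.s<s⁻¹ i+1<N+1
      i<N+1 = ℕ.m<n⇒m<1+n i<N

    hankel-det : ∀ n t (H : Matrix n) → (∀ i j → H i j ≈ t * L (toℕ i ℕ.+ toℕ j) 0) →
                 det n H ≈ prodFin n (λ k → t * Λ lam (toℕ k))
    hankel-det n t H H≈tL = begin
      det n H
        ≈⟨ det-*-unitriangular M V H (λ r s → upper-vanishes (toℕ s) (toℕ r)) (diagonal ∘ toℕ) H≈MV ⟩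
      det n M
        ≈⟨ det-lowerTriangular M (λ i r i<r → zeroˡ-≈ _ (upper-vanishes _ _ i<r)) ⟩
      prodFin n (λ i → M i i)
        ≈⟨ Π-cong n (λ i → trans (*-congʳ (diagonal (toℕ i))) (*-identityˡ _)) ⟩
      prodFin n (λ k → t * Λ lam (toℕ k))
        ∎
      where
      M V : Matrix n
      M i r = L (toℕ i) (toℕ r) * (t * Λ lam (toℕ r))
      V r j = L (toℕ j) (toℕ r)
      regroup : ∀ t x y w → t * (x * (y * w)) ≈ (x * (t * w)) * y
      regroup = solve 4 (λ t x y w → (t :* (x :* (y :* w))) := ((x :* (t :* w)) :* y)) refl
      H≈MV : ∀ i j → H i j ≈ sumFin n (λ r → M i r * V r j)
      H≈MV i j = begin
        H i j
          ≈⟨ H≈tL i j ⟩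
        t * L (toℕ i ℕ.+ toℕ j) 0
          ≈⟨ *-congˡ (hankel-pairing n (toℕ i) (toℕ j) (FinP.toℕ<n i)) ⟩
        t * pairing lam n (L (toℕ i)) (L (toℕ j))
          ≈⟨ Σ-*ˡ n t _ ⟩
        sumFin n (λ r → t * (L (toℕ i) (toℕ r) * (L (toℕ j) (toℕ r) * Λ lam (toℕ r))))
          ≈⟨ Σ-cong n (λ r → regroup _ _ _ _) ⟩
        sumFin n (λ r → M i r * V r j)
          ∎

  bidiagonal-isStieltjesTable : ∀ {c : ℕ → Carrier} {W : ℕ → ℕ → Carrier} →
    W 0 0 ≈ 1# → (∀ k → W 0 (suc k) ≈ 0#) → (∀ n k → W (suc n) k ≈ shiftRow (W n) k + c k * W n k) →
    IsStieltjesTable c (λ _ → 0#) W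
  bidiagonal-isStieltjesTable W₀₀≈1 W₀ₖ≈0 W-rec = record
    { initial-diag = W₀₀≈1
    ; initial-off  = W₀ₖ≈0
    ; recurrence   = λ n k → trans (W-rec n k) (+-congˡ (sym (trans (+-congˡ (zeroˡ _)) (+-identityʳ _))))
    }

  _⊙_ : (W Q : ℕ → ℕ → Carrier) → ℕ → ℕ → Carrier
  (W ⊙ Q) n k = sumℕ (suc n) (λ a → W n a * Q a k)

  ⊙-isStieltjesTable : ∀ {b lam c : ℕ → Carrier} {W Q : ℕ → ℕ → Carrier} →
    IsStieltjesTable c (λ _ → 0#) W → Q 0 0 ≈ 1# → (∀ k → Q 0 (suc k) ≈ 0#) →
    (∀ a k → Q (suc a) k + c a * Q a k ≈ jacobi b lam (Q a) k) → IsStieltjesTable b lam (W ⊙ Q)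
  ⊙-isStieltjesTable {b} {lam} {c} {W} {Q} W-table Q₀₀≈1 Q₀ₖ≈0 Q-step = record
    { initial-diag = trans (+-identityʳ _) (trans (*-cong initial-diag Q₀₀≈1) (*-identityˡ _))
    ; initial-off  = λ k → trans (+-identityʳ _) (zeroʳ-≈ _ (Q₀ₖ≈0 k))
    ; recurrence   = ⊙-recurrence
    }
    where
    open IsStieltjesTable W-table
    open StieltjesTable W-table using (upper-vanishes)
    ⊙-recurrence : ∀ n k → (W ⊙ Q) (suc n) k ≈ jacobi b lam ((W ⊙ Q) n) k
    ⊙-recurrence n k = begin
      sumℕ (suc (suc n)) (λ a → W (suc n) a * Q a k)
        ≈⟨ Σ-cong (suc (suc n)) (W-bidiagonal ∘ toℕ) ⟩
      sumℕ (suc (suc n)) (λ a → shiftRow (W n) a * Q a k + (c a * W n a) * Q a k)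
        ≈⟨ Σ-+ (suc (suc n)) (down ∘ toℕ) (level ∘ toℕ) ⟩
      sumℕ (suc (suc n)) down + sumℕ (suc (suc n)) level
        ≈⟨ +-cong (trans (+-congʳ (zeroˡ _)) (+-identityˡ _))
                  (Σ-dropLastℕ (suc n) level (zeroˡ-≈ _ (zeroʳ-≈ _ (upper-vanishes n (suc n) (ℕ.n<1+n n))))) ⟩
      sumℕ (suc n) (λ a → W n a * Q (suc a) k) + sumℕ (suc n) level
        ≈⟨ Σ-+ (suc n) (λ a → W n (toℕ a) * Q (suc (toℕ a)) k) (level ∘ toℕ) ⟨
      sumℕ (suc n) (λ a → W n a * Q (suc a) k + level a)
        ≈⟨ Σ-cong (suc n) (λ a → trans (regroup (W n (toℕ a)) _ _ _) (*-congˡ (Q-step (toℕ a) k))) ⟩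
      sumℕ (suc n) (λ a → W n a * jacobi b lam (Q a) k)
        ≈⟨ jacobi-linear b lam (suc n) (W n) Q k ⟩
      jacobi b lam ((W ⊙ Q) n) k
        ∎
      where
      down level : ℕ → Carrier
      down  a = shiftRow (W n) a * Q a k
      level a = (c a * W n a) * Q a k
      W-bidiagonal : ∀ a → W (suc n) a * Q a k ≈ down a + level a
      W-bidiagonal a = trans (*-congʳ (trans (recurrence n a) (+-congˡ (trans (+-congˡ (zeroˡ _)) (+-identityʳ _)))))
                             (distribʳ _ _ _)
      regroup : ∀ w q₁ c q₀ → w * q₁ + (c * w) * q₀ ≈ w * (q₁ + c * q₀)
      regroup = solve 4 (λ w q₁ c q₀ → (w :* q₁ :+ (c :* w) :* q₀) := (w :* (q₁ :+ c :* q₀))) refl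

  -- The q-Stirling Hankel determinants

  module QStirlingHankel (q x : Carrier) where

    [_] : ℕ → Carrier
    [ n ] = qint q n

    P : ℕ → ℕ → Carrier
    P zero    zero    = 1#
    P zero    (suc k) = 0#
    P (suc a) k       = shiftRow (P a) k + x * (pow q k * P a k)

    P-col0 : ∀ a → P a 0 ≈ pow x a
    P-col0 zero    = refl
    P-col0 (suc a) = trans (+-identityˡ _) (*-congˡ (trans (*-identityˡ _) (P-col0 a)))

    qint-P : ∀ a k → [ a ] * P a k ≈ [ k ] * P a k + x * (pow q k * ([ suc k ] * P a (suc k)))
    qint-P zero zero = solve 2 (λ q x → (con 0 :* con 1)
                                        := (con 0 :* con 1 :+ x :* (con 1 :* ((con 1 :+ q :* con 0) :* con 0)))) refl q x
    qint-P zero (suc k) = solve 4 (λ t p t′ x → (con 0 :* con 0) := (t :* con 0 :+ x :* (p :* (t′ :* con 0)))) refl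
      [ suc k ] (pow q (suc k)) [ suc (suc k) ] x
    qint-P (suc a) zero = begin
      (1# + q * s) * (0# + x * (1# * β))                            ≈⟨ expand ⟩
      x * β + (q * x) * (s * β)                                     ≈⟨ +-congˡ (*-congˡ (qint-P a 0)) ⟩
      x * β + (q * x) * (0# * β + x * (1# * ((1# + q * 0#) * γ)))  ≈⟨ collect ⟩
      0# * (0# + x * (1# * β)) + x * (1# * ((1# + q * 0#) * (β + x * ((q * 1#) * γ)))) ∎
      where
      s = [ a ]
      β = P a 0
      γ = P a 1
      expand = solve 4 (λ q s x β → ((con 1 :+ q :* s) :* (con 0 :+ x :* (con 1 :* β)))
                                    := (x :* β :+ (q :* x) :* (s :* β))) refl q s x β
      collect = solve 4 (λ q x β γ →
        (x :* β :+ (q :* x) :* (con 0 :* β :+ x :* (con 1 :* ((con 1 :+ q :* con 0) :* γ))))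
        := (con 0 :* (con 0 :+ x :* (con 1 :* β))
            :+ x :* (con 1 :* ((con 1 :+ q :* con 0) :* (β :+ x :* ((q :* con 1) :* γ))))))
        refl q x β γ
    qint-P (suc a) (suc k) = begin
      (1# + q * s) * (α + x * (p′ * β))
        ≈⟨ expand ⟩
      α + (x * p′) * β + (q * (s * α) + (q * (x * p′)) * (s * β))
        ≈⟨ +-congˡ (+-cong (*-congˡ (qint-P a k)) (*-congˡ (qint-P a (suc k)))) ⟩
      α + (x * p′) * β + (q * (t * α + x * (p * (t′ * β))) + (q * (x * p′)) * (t′ * β + x * (p′ * (t″ * γ))))
        ≈⟨ collect ⟩
      t′ * (α + x * (p′ * β)) + x * (p′ * (t″ * (β + x * ((q * p′) * γ))))
        ∎
      where
      s  = [ a ]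
      t  = [ k ]
      t′ = 1# + q * t
      t″ = 1# + q * t′
      p  = pow q k
      p′ = q * p
      α  = P a k
      β  = P a (suc k)
      γ  = P a (suc (suc k))
      expand = solve 6 (λ q s α x p β → ((con 1 :+ q :* s) :* (α :+ x :* ((q :* p) :* β)))
        := (α :+ (x :* (q :* p)) :* β :+ (q :* (s :* α) :+ (q :* (x :* (q :* p))) :* (s :* β)))) refl q s α x p β
      collect = solve 7 (λ q t α x p β γ →
        (α :+ (x :* (q :* p)) :* β
         :+ (q :* (t :* α :+ x :* (p :* ((con 1 :+ q :* t) :* β)))
             :+ (q :* (x :* (q :* p))) :* ((con 1 :+ q :* t) :* β
                                          :+ x :* ((q :* p) :* ((con 1 :+ q :* (con 1 :+ q :* t)) :* γ)))))
        := ((con 1 :+ q :* t) :* (α :+ x :* ((q :* p) :* β))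
            :+ x :* ((q :* p) :* ((con 1 :+ q :* (con 1 :+ q :* t)) :* (β :+ x :* ((q :* (q :* p)) :* γ))))))
        refl q t α x p β γ

    P-jacobi : ∀ (c b lam : ℕ → Carrier) →
      (∀ a k → x * (pow q k * P a k) + c a * P a k ≈ b k * P a k + lam k * P a (suc k)) →
      ∀ a k → P (suc a) k + c a * P a k ≈ jacobi b lam (P a) k
    P-jacobi c b lam P-level a k = trans (+-assoc _ _ _) (+-congˡ (P-level a k))

    b₁ lam₁ b₂ lam₂ : ℕ → Carrier
    b₁ k   = x * pow q k + [ k ]
    lam₁ k = x * (pow q k * [ suc k ])
    b₂ k   = x * pow q k + [ suc k ]
    lam₂ k = x * (pow q (suc k) * [ suc k ])

    S₁ S₂ : ℕ → ℕ → Carrier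
    S₁ n k = qS q n k
    S₂ n k = qS q (suc n) (suc k)

    S₁-table : IsStieltjesTable [_] (λ _ → 0#) S₁
    S₁-table = bidiagonal-isStieltjesTable refl (λ _ → refl) recurrence
      where
      recurrence : ∀ n k → S₁ (suc n) k ≈ shiftRow (S₁ n) k + [ k ] * S₁ n k
      recurrence n zero    = sym (trans (+-identityˡ _) (zeroˡ _))
      recurrence n (suc k) = refl

    S₂-table : IsStieltjesTable (λ k → [ suc k ]) (λ _ → 0#) S₂
    S₂-table = bidiagonal-isStieltjesTable (trans (+-congˡ (zeroʳ _)) (+-identityʳ _))
                                           (λ _ → trans (+-identityˡ _) (zeroʳ _)) recurrence
      where
      recurrence : ∀ n k → S₂ (suc n) k ≈ shiftRow (S₂ n) k + [ suc k ] * S₂ n k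
      recurrence n zero    = refl
      recurrence n (suc k) = refl

    L₁-table : IsStieltjesTable b₁ lam₁ (S₁ ⊙ P)
    L₁-table = ⊙-isStieltjesTable S₁-table refl (λ _ → refl) (P-jacobi [_] b₁ lam₁ P-level)
      where
      P-level : ∀ a k → x * (pow q k * P a k) + [ a ] * P a k ≈ b₁ k * P a k + lam₁ k * P a (suc k)
      P-level a k = trans (+-congˡ (qint-P a k)) (solve 6 (λ x p α t t′ β →
        (x :* (p :* α) :+ (t :* α :+ x :* (p :* (t′ :* β)))) := ((x :* p :+ t) :* α :+ (x :* (p :* t′)) :* β)) refl
        x (pow q k) (P a k) [ k ] [ suc k ] (P a (suc k)))

    L₂-table : IsStieltjesTable b₂ lam₂ (S₂ ⊙ P)
    L₂-table = ⊙-isStieltjesTable S₂-table refl (λ _ → refl) (P-jacobi (λ a → [ suc a ]) b₂ lam₂ P-level)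
      where
      P-level : ∀ a k → x * (pow q k * P a k) + [ suc a ] * P a k ≈ b₂ k * P a k + lam₂ k * P a (suc k)
      P-level a k = begin
        x * (p * α) + (1# + q * [ a ]) * α
          ≈⟨ solve 5 (λ x p α q s → (x :* (p :* α) :+ (con 1 :+ q :* s) :* α)
                                    := (x :* (p :* α) :+ α :+ q :* (s :* α))) refl x p α q [ a ] ⟩
        x * (p * α) + α + q * ([ a ] * α)
          ≈⟨ +-congˡ (*-congˡ (qint-P a k)) ⟩
        x * (p * α) + α + q * ([ k ] * α + x * (p * ([ suc k ] * β)))
          ≈⟨ solve 6 (λ x p α q t β → (x :* (p :* α) :+ α :+ q :* (t :* α :+ x :* (p :* ((con 1 :+ q :* t) :* β))))
                                      := ((x :* p :+ (con 1 :+ q :* t)) :* α :+ (x :* ((q :* p) :* (con 1 :+ q :* t))) :* β))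
                     refl x p α q [ k ] β ⟩
        b₂ k * α + lam₂ k * β
          ∎
        where
        p = pow q k
        α = P a k
        β = P a (suc k)

    φ≈L₁ : ∀ n → φ q x n ≈ (S₁ ⊙ P) n 0
    φ≈L₁ n = Σ-cong (suc n) (λ a → *-congˡ {qS q n (toℕ a)} (sym (P-col0 (toℕ a))))

    φ-suc≈x*L₂ : ∀ n → φ q x (suc n) ≈ x * (S₂ ⊙ P) n 0
    φ-suc≈x*L₂ n = begin
      qS q (suc n) 0 * 1# + sumℕ (suc n) (λ c → S₂ n c * pow x (suc c))
        ≈⟨ trans (+-congʳ (zeroˡ _)) (+-identityˡ _) ⟩
      sumℕ (suc n) (λ c → S₂ n c * (x * pow x c))
        ≈⟨ Σ-cong (suc n) (x-out ∘ toℕ) ⟩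
      sumℕ (suc n) (λ c → x * (S₂ n c * P c 0))
        ≈⟨ Σ-*ˡ (suc n) x (λ c → S₂ n (toℕ c) * P (toℕ c) 0) ⟨
      x * (S₂ ⊙ P) n 0
        ∎
      where
      x-out : ∀ c → S₂ n c * (x * pow x c) ≈ x * (S₂ n c * P c 0)
      x-out c = trans (*-congˡ (*-congˡ (sym (P-col0 c))))
                      (solve 3 (λ s x z → (s :* (x :* z)) := (x :* (s :* z))) refl (S₂ n c) x (P c 0))

    Λ-monomial : ∀ (lam : ℕ → Carrier) (d E : ℕ → ℕ) → (∀ k → lam k ≈ x * (pow q (d k) * [ suc k ])) →
      E 0 ≡ 0 → (∀ k → E (suc k) ≡ d k ℕ.+ E k) → ∀ k → Λ lam k ≈ pow x k * (pow q (E k) * qfact q k)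
    Λ-monomial lam d E lam≈ E₀≡0 E-suc zero =
      sym (trans (*-identityˡ _) (trans (*-identityʳ _) (reflexive (≡.cong (pow q) E₀≡0))))
    Λ-monomial lam d E lam≈ E₀≡0 E-suc (suc k) = begin
      lam k * Λ lam k
        ≈⟨ *-cong (lam≈ k) (Λ-monomial lam d E lam≈ E₀≡0 E-suc k) ⟩
      (x * (pow q (d k) * [ suc k ])) * (pow x k * (pow q (E k) * qfact q k))
        ≈⟨ regroup _ _ _ _ _ _ ⟩
      (x * pow x k) * ((pow q (d k) * pow q (E k)) * (qfact q k * [ suc k ]))
        ≈⟨ *-congˡ (*-congʳ (trans (sym (pow-+ q (d k) (E k))) (reflexive (≡.cong (pow q) (≡.sym (E-suc k)))))) ⟩
      pow x (suc k) * (pow q (E (suc k)) * qfact q (suc k))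
        ∎
      where
      regroup : ∀ x p t X Q F → (x * (p * t)) * (X * (Q * F)) ≈ (x * X) * ((p * Q) * (F * t))
      regroup = solve 6 (λ x p t X Q F → ((x :* (p :* t)) :* (X :* (Q :* F))) := ((x :* X) :* ((p :* Q) :* (F :* t)))) refl

    Λ₁ : ∀ k → Λ lam₁ k ≈ pow x k * (pow q (k C 2) * qfact q k)
    Λ₁ = Λ-monomial lam₁ (λ k → k) (_C 2) (λ _ → refl) ≡.refl suc-C-2

    Λ₂ : ∀ k → Λ lam₂ k ≈ pow x k * (pow q (suc k C 2) * qfact q k)
    Λ₂ = Λ-monomial lam₂ suc (λ k → suc k C 2) (λ _ → refl) ≡.refl (suc-C-2 ∘ suc)

    hankel-φ : ∀ n → det n (λ i j → φ q x (toℕ i ℕ.+ toℕ j))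
                     ≈ pow x (n C 2) * (pow q (n C 3) * prodFin n (λ j → qfact q (toℕ j)))
    hankel-φ n = begin
      det n (λ i j → φ q x (toℕ i ℕ.+ toℕ j))
        ≈⟨ StieltjesTable.hankel-det L₁-table n 1# _ (λ i j → trans (φ≈L₁ (toℕ i ℕ.+ toℕ j)) (sym (*-identityˡ _))) ⟩
      prodFin n (λ k → 1# * Λ lam₁ (toℕ k))
        ≈⟨ Π-cong n (λ k → trans (*-identityˡ _) (Λ₁ (toℕ k))) ⟩
      prodFin n (λ k → pow x (toℕ k) * (pow q (toℕ k C 2) * qfact q (toℕ k)))
        ≈⟨ Π-*₃ n _ _ _ ⟩
      prodFin n (λ k → pow x (toℕ k)) * (prodFin n (λ k → pow q (toℕ k C 2)) * prodFin n (λ k → qfact q (toℕ k)))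
        ≈⟨ *-cong (Π-pow-id x n) (*-congʳ (Π-pow-choose q 2 n)) ⟩
      pow x (n C 2) * (pow q (n C 3) * prodFin n (λ k → qfact q (toℕ k)))
        ∎

    hankel-φ-suc : ∀ n → det n (λ i j → φ q x (suc (toℕ i ℕ.+ toℕ j)))
                         ≈ pow x (suc n C 2) * (pow q (suc n C 3) * prodFin n (λ j → qfact q (toℕ j)))
    hankel-φ-suc n = begin
      det n (λ i j → φ q x (suc (toℕ i ℕ.+ toℕ j)))
        ≈⟨ StieltjesTable.hankel-det L₂-table n x _ (λ i j → φ-suc≈x*L₂ (toℕ i ℕ.+ toℕ j)) ⟩
      prodFin n (λ k → x * Λ lam₂ (toℕ k))
        ≈⟨ Π-cong n (λ k → trans (*-congˡ (Λ₂ (toℕ k))) (sym (*-assoc _ _ _))) ⟩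
      prodFin n (λ k → pow x (suc (toℕ k)) * (pow q (suc (toℕ k) C 2) * qfact q (toℕ k)))
        ≈⟨ Π-*₃ n _ _ _ ⟩
      prodFin n (λ k → pow x (suc (toℕ k)))
        * (prodFin n (λ k → pow q (suc (toℕ k) C 2)) * prodFin n (λ k → qfact q (toℕ k)))
        ≈⟨ *-cong (trans (sym (*-identityˡ _)) (Π-pow-id x (suc n)))
                  (*-congʳ (trans (sym (*-identityˡ _)) (Π-pow-choose q 2 (suc n)))) ⟩
      pow x (suc n C 2) * (pow q (suc n C 3) * prodFin n (λ k → qfact q (toℕ k)))
        ∎

open import Data.Nat using (ℕ; suc; _+_)
open import Data.Fin using (toℕ)
open import Data.Nat.Combinatorics using (_C_)
open import Data.Product using (_×_)
open import Algebra.Bundles using (CommutativeRing)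
open QStirling using (det; φ; pow; prodFin; qfact)
open CommutativeRing using (_≈_; _*_)

theorem1 : ∀ {c ℓ} (R : CommutativeRing c ℓ) (q x : CommutativeRing.Carrier R) (m : ℕ) →
    (_≈_ R (det R (suc m) (λ i j → φ R q x (toℕ i + toℕ j)))
       (_*_ R (pow R x (suc m C 2)) (_*_ R (pow R q (suc m C 3)) (prodFin R (suc m) (λ j → qfact R q (toℕ j))))))
    ×
    (_≈_ R (det R (suc m) (λ i j → φ R q x (suc (toℕ i + toℕ j))))
       (_*_ R (pow R x (suc (suc m) C 2)) (_*_ R (pow R q (suc (suc m) C 3)) (prodFin R (suc m) (λ j → qfact R q (toℕ j))))))
theorem1 R q x m = hankel-φ R q x (suc m) , hankel-φ-suc R q x (suc m)
  where open QStirlingHankel
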